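{- Every hypercircuit is partition-connected: if $H=(V,E)$ is a hypercircuit, then for every partition $\mathcal P$ of $V$ into nonempty parts, the number $N(\mathcal P)$ of edges of $E$ having vertices in at least two parts of $\mathcal P$ satisfies $N(\mathcal P)\ge|\mathcal P|-1$.
   Context: A hypergraph $H=(V,E)$ has a finite vertex set and a set $E$ of nonempty subsets of $V$. For $X\subseteq V$, $\Gamma(X)$ is the set of edges $e\in E$ with $e\cap X\ne\emptyset$. $H$ is a hypercircuit if $|V|=|E|$ and $|\Gamma(X)|\ge|X|+1$ for every nonempty proper subset $X\subsetneq V$. A hypergraph is partition-connected if every partition $\mathcal P$ of its vertex set satisfies $N(\mathcal P)\ge|\mathcal P|-1$. -}

module Defs where

open import Data.Nat using (ℕ; _≤_; _+_; _∸_; suc)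
open import Data.Fin using (Fin; _≟_)
open import Data.Fin.Properties using (any?)
open import Data.Fin.Subset using (Subset; _∈_; _∩_; ∣_∣; ⊤; Nonempty)
open import Data.Fin.Subset.Properties using (nonempty?; _∈?_)
open import Data.Vec using (tabulate)
open import Data.Product using (_×_; ∃; Σ)
open import Function.Definitions using (Injective)
open import Function using (Surjective)
open import Relation.Binary.PropositionalEquality using (_≡_; _≢_)
open import Relation.Nullary using (¬_; does; ¬?; _×-dec_)

-- E is a *set* of nonempty subsets of V: we index the edges by Fin m
-- and require the indexing to be injective (distinct edges) and every
-- edge to be nonempty.
record Hypergraph (n m : ℕ) : Set where
  field
    edge     : Fin m → Subset n
    distinct : Injective _≡_ _≡_ edge
    nonempty : ∀ j → Nonempty (edge j)
open Hypergraph public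

Γ : ∀ {n m} → Hypergraph n m → Subset n → Subset m
Γ H X = tabulate (λ j → does (nonempty? (edge H j ∩ X)))

IsHypercircuit : ∀ {n m} → Hypergraph n m → Set
IsHypercircuit {n} {m} H =
  (n ≡ m) ×
  (∀ (X : Subset n) → Nonempty X → X ≢ ⊤ → suc ∣ X ∣ ≤ ∣ Γ H X ∣)

-- A partition of V = Fin n into k nonempty parts is represented by a
-- surjective labelling p : Fin n → Fin k (part i is p⁻¹(i); surjectivity
-- says every part is nonempty).  |P| = k.
IsPartition : ∀ {n k} → (Fin n → Fin k) → Set
IsPartition p = Surjective _≡_ _≡_ p

crossing : ∀ {n m k} → Hypergraph n m → (Fin n → Fin k) → Subset m
crossing H p = tabulate λ j →
  does (any? λ u → any? λ v →
          ((u ∈? edge H j) ×-dec (v ∈? edge H j)) ×-dec ¬? (p u ≟ p v))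

N : ∀ {n m k} → Hypergraph n m → (Fin n → Fin k) → ℕ
N H p = ∣ crossing H p ∣

PartitionConnected : ∀ {n m} → Hypergraph n m → Set
PartitionConnected {n} H =
  ∀ (k : ℕ) (p : Fin n → Fin k) → IsPartition p → k ∸ 1 ≤ N H p

-- Cut V along a partition into parts P₁,…,P_k with k ≥ 2.  Applying the hypercircuit
-- inequality to the complement of P_i shows that fewer than |P_i| edges lie inside P_i.
-- A non-crossing edge lies inside the part of any of its vertices, so
-- |E| ≤ N(P) + Σᵢ (|P_i| − 1) = N(P) + |V| − k, and |V| = |E| gives N(P) ≥ k.
module Submission where

open import Defs
open import Data.Bool using (Bool; true; false)
open import Data.Nat using (ℕ; zero; suc; _+_; _≤_; _<_; z≤n)
open import Data.Nat.Properties
  using (≤-trans; ≤-reflexive; n≤1+n; m≤m+n; m≤n+m; +-mono-≤; +-monoˡ-≤; +-comm; +-suc;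
         +-cancelʳ-≤; +-cancelˡ-≤; m∸n+n≡m; +-0-commutativeMonoid; module ≤-Reasoning)
open import Data.Fin using (Fin; zero; suc; _≟_; punchIn)
open import Data.Fin.Properties using (any?; punchInᵢ≢i)
open import Data.Fin.Subset using (Subset; _∈_; _∩_; ∁; ∣_∣; ⊤; Nonempty; inside; outside)
open import Data.Fin.Subset.Properties
  using (nonempty?; _∈?_; ∣p∣≤n; ∣∁p∣≡n∸∣p∣; ∈⊤; x∈p⇒x∉∁p; x∈∁p⇒x∉p; x∉p⇒x∈∁p; x∈p∩q⁻)
open import Data.Vec using ([]; _∷_; lookup; tabulate)
open import Data.Vec.Properties using (lookup∘tabulate; []=⇒lookup; lookup⇒[]=)
open import Data.Product using (∃; _×_; _,_; proj₁; proj₂)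
open import Data.Sum using (_⊎_; inj₁; inj₂)
open import Function using (_∘_)
open import Relation.Binary.PropositionalEquality
open import Relation.Nullary using (¬_; ¬?; Dec; does; yes; no; _×-dec_)
open import Relation.Nullary.Decidable using (dec-true)
open import Algebra.Properties.CommutativeMonoid.Sum +-0-commutativeMonoid
  using (sum; sum-syntax; sum-replicate-zero; sum-cong-≗; ∑-distrib-+; ∑-comm)

private
  variable
    n m k : ℕ

𝟙 : Bool → ℕ
𝟙 true  = 1
𝟙 false = 0

∑-const-1 : ∀ n → ∑[ i < n ] 1 ≡ n
∑-const-1 zero    = refl
∑-const-1 (suc n) = cong suc (∑-const-1 n)

∑-mono-≤ : {f g : Fin n → ℕ} → (∀ i → f i ≤ g i) → sum f ≤ sum g
∑-mono-≤ {zero}  f≤g = z≤n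
∑-mono-≤ {suc n} f≤g = +-mono-≤ (f≤g zero) (∑-mono-≤ (f≤g ∘ suc))

≤-∑ : (f : Fin n → ℕ) (i : Fin n) → f i ≤ sum f
≤-∑ f zero    = m≤m+n (f zero) _
≤-∑ f (suc i) = ≤-trans (≤-∑ (f ∘ suc) i) (m≤n+m _ (f zero))

∑-𝟙-≟ : (a : Fin k) → ∑[ i < k ] 𝟙 (does (a ≟ i)) ≡ 1
∑-𝟙-≟ {suc k} zero    = cong suc (sum-replicate-zero k)
∑-𝟙-≟ {suc k} (suc a) = ∑-𝟙-≟ a

∣p∣≡∑𝟙 : (p : Subset n) → ∣ p ∣ ≡ ∑[ x < n ] 𝟙 (lookup p x)
∣p∣≡∑𝟙 []            = refl
∣p∣≡∑𝟙 (inside  ∷ p) = cong suc (∣p∣≡∑𝟙 p)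
∣p∣≡∑𝟙 (outside ∷ p) = ∣p∣≡∑𝟙 p

x∈p⇒𝟙≡1 : {p : Subset n} {x : Fin n} → x ∈ p → 𝟙 (lookup p x) ≡ 1
x∈p⇒𝟙≡1 x∈p = cong 𝟙 ([]=⇒lookup x∈p)

∣∁p∣+∣p∣≡n : (p : Subset n) → ∣ ∁ p ∣ + ∣ p ∣ ≡ n
∣∁p∣+∣p∣≡n {n} p = trans (cong (_+ ∣ p ∣) (∣∁p∣≡n∸∣p∣ p)) (m∸n+n≡m (∣p∣≤n p))

∈tabulate⁺ : {P : Fin n → Set} (P? : ∀ x → Dec (P x)) {x : Fin n} →
             P x → x ∈ tabulate (λ y → does (P? y))
∈tabulate⁺ P? {x} px =
  lookup⇒[]= x (tabulate _) (trans (lookup∘tabulate _ x) (dec-true (P? x) px))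

∈tabulate⁻ : {P : Fin n → Set} (P? : ∀ x → Dec (P x)) {x : Fin n} →
             x ∈ tabulate (λ y → does (P? y)) → P x
∈tabulate⁻ P? {x} x∈ with P? x | trans (sym (lookup∘tabulate _ x)) ([]=⇒lookup x∈)
... | yes px | _  = px
... | no  _  | ()

Nonempty⇒∁≢⊤ : {p : Subset n} → Nonempty p → ∁ p ≢ ⊤
Nonempty⇒∁≢⊤ (x , x∈p) ∁p≡⊤ = x∈p⇒x∉∁p x∈p (subst (x ∈_) (sym ∁p≡⊤) ∈⊤)

edgesWithin : Hypergraph n m → Subset n → Subset m
edgesWithin H C = ∁ (Γ H (∁ C))

∈edgesWithin⁺ : (H : Hypergraph n m) {C : Subset n} {j : Fin m} →
                ¬ Nonempty (edge H j ∩ ∁ C) → j ∈ edgesWithin H C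
∈edgesWithin⁺ H {C} ¬meets∁C =
  x∉p⇒x∈∁p (¬meets∁C ∘ ∈tabulate⁻ (λ i → nonempty? (edge H i ∩ ∁ C)))

crosses? : (H : Hypergraph n m) (p : Fin n → Fin k) (j : Fin m) →
           Dec (∃ λ u → ∃ λ v → (u ∈ edge H j × v ∈ edge H j) × p u ≢ p v)
crosses? H p j = any? λ u → any? λ v →
  ((u ∈? edge H j) ×-dec (v ∈? edge H j)) ×-dec ¬? (p u ≟ p v)

∈crossing⁺ : (H : Hypergraph n m) (p : Fin n → Fin k) {j : Fin m} {u v : Fin n} →
             u ∈ edge H j → v ∈ edge H j → p u ≢ p v → j ∈ crossing H p
∈crossing⁺ H p u∈e v∈e pu≢pv = ∈tabulate⁺ (crosses? H p) (_ , _ , (u∈e , v∈e) , pu≢pv)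

∣edgesWithin∣<∣C∣ : (H : Hypergraph n m) → IsHypercircuit H → {C : Subset n} →
                    Nonempty C → Nonempty (∁ C) → ∣ edgesWithin H C ∣ < ∣ C ∣
∣edgesWithin∣<∣C∣ {n} H (refl , hc) {C} C≠∅ ∁C≠∅ = +-cancelˡ-≤ ∣ ∁ C ∣ _ _ (begin
  ∣ ∁ C ∣ + suc ∣ W ∣    ≡⟨ +-suc ∣ ∁ C ∣ ∣ W ∣ ⟩
  suc ∣ ∁ C ∣ + ∣ W ∣    ≤⟨ +-monoˡ-≤ ∣ W ∣ (hc (∁ C) ∁C≠∅ (Nonempty⇒∁≢⊤ C≠∅)) ⟩
  ∣ Γ H (∁ C) ∣ + ∣ W ∣  ≡⟨ +-comm ∣ Γ H (∁ C) ∣ ∣ W ∣ ⟩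
  ∣ W ∣ + ∣ Γ H (∁ C) ∣  ≡⟨ ∣∁p∣+∣p∣≡n (Γ H (∁ C)) ⟩
  n                      ≡⟨ ∣∁p∣+∣p∣≡n C ⟨
  ∣ ∁ C ∣ + ∣ C ∣        ∎)
  where
  open ≤-Reasoning
  W = edgesWithin H C

part : (Fin n → Fin k) → Fin k → Subset n
part p i = tabulate (λ u → does (p u ≟ i))

∈part⁺ : (p : Fin n → Fin k) {i : Fin k} {u : Fin n} → p u ≡ i → u ∈ part p i
∈part⁺ p {i} = ∈tabulate⁺ (λ u → p u ≟ i)

∈part⁻ : (p : Fin n → Fin k) {i : Fin k} {u : Fin n} → u ∈ part p i → p u ≡ i
∈part⁻ p {i} = ∈tabulate⁻ (λ u → p u ≟ i)

part-nonempty : {p : Fin n → Fin k} → IsPartition p → (i : Fin k) → Nonempty (part p i)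
part-nonempty {p = p} surj i = proj₁ (surj i) , ∈part⁺ p (proj₂ (surj i) refl)

∁part-nonempty : {p : Fin n → Fin (suc (suc k))} → IsPartition p →
                 (i : Fin (suc (suc k))) → Nonempty (∁ (part p i))
∁part-nonempty {p = p} surj i =
  u , x∉p⇒x∈∁p (λ u∈Pᵢ → punchInᵢ≢i i zero (trans (sym pu≡j) (∈part⁻ p u∈Pᵢ)))
  where
  u = proj₁ (surj (punchIn i zero))
  pu≡j = proj₂ (surj (punchIn i zero)) refl

∑∣part∣≡n : (p : Fin n → Fin k) → ∑[ i < k ] ∣ part p i ∣ ≡ n
∑∣part∣≡n {n} {k} p = begin
  ∑[ i < k ] ∣ part p i ∣                       ≡⟨ sum-cong-≗ (∣p∣≡∑𝟙 ∘ part p) ⟩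
  ∑[ i < k ] ∑[ u < n ] 𝟙 (lookup (part p i) u)
    ≡⟨ sum-cong-≗ (λ i → sum-cong-≗ (cong 𝟙 ∘ lookup∘tabulate (λ u → does (p u ≟ i)))) ⟩
  ∑[ i < k ] ∑[ u < n ] 𝟙 (does (p u ≟ i))      ≡⟨ ∑-comm (λ i u → 𝟙 (does (p u ≟ i))) ⟩
  ∑[ u < n ] ∑[ i < k ] 𝟙 (does (p u ≟ i))      ≡⟨ sum-cong-≗ (∑-𝟙-≟ ∘ p) ⟩
  ∑[ u < n ] 1                                  ≡⟨ ∑-const-1 n ⟩
  n                                             ∎
  where open ≡-Reasoning

crossing-or-within-part : (H : Hypergraph n m) (p : Fin n → Fin k) (j : Fin m) →
                          j ∈ crossing H p ⊎ ∃ λ i → j ∈ edgesWithin H (part p i)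
crossing-or-within-part H p j with nonempty H j
... | u , u∈e with nonempty? (edge H j ∩ ∁ (part p (p u)))
...   | no ¬meets∁P = inj₂ (p u , ∈edgesWithin⁺ H ¬meets∁P)
...   | yes (v , v∈e∩∁P) =
  let v∈e , v∈∁P = x∈p∩q⁻ (edge H j) _ v∈e∩∁P
  in  inj₁ (∈crossing⁺ H p u∈e v∈e λ pu≡pv → x∈∁p⇒x∉p v∈∁P (∈part⁺ p (sym pu≡pv)))

m≤N+∑∣edgesWithin∣ : (H : Hypergraph n m) (p : Fin n → Fin k) →
                     m ≤ N H p + ∑[ i < k ] ∣ edgesWithin H (part p i) ∣
m≤N+∑∣edgesWithin∣ {m = m} {k = k} H p = begin
  m                                                    ≡⟨ ∑-const-1 m ⟨
  ∑[ j < m ] 1                                         ≤⟨ ∑-mono-≤ counted ⟩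
  ∑[ j < m ] (𝟙 (lookup cr j) + ∑[ i < k ] 𝟙 (lookup (W i) j))
    ≡⟨ ∑-distrib-+ (𝟙 ∘ lookup cr) (λ j → ∑[ i < k ] 𝟙 (lookup (W i) j)) ⟩
  ∑[ j < m ] 𝟙 (lookup cr j) + ∑[ j < m ] ∑[ i < k ] 𝟙 (lookup (W i) j)
    ≡⟨ cong₂ _+_ (∣p∣≡∑𝟙 cr) (∑-comm (λ i j → 𝟙 (lookup (W i) j))) ⟨
  N H p + ∑[ i < k ] ∑[ j < m ] 𝟙 (lookup (W i) j)     ≡⟨ cong (N H p +_) (sum-cong-≗ (∣p∣≡∑𝟙 ∘ W)) ⟨
  N H p + ∑[ i < k ] ∣ W i ∣                           ∎
  where
  open ≤-Reasoning
  cr = crossing H p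
  W = edgesWithin H ∘ part p
  counted : ∀ j → 1 ≤ 𝟙 (lookup cr j) + ∑[ i < k ] 𝟙 (lookup (W i) j)
  counted j with crossing-or-within-part H p j
  ... | inj₁ j∈cr       = ≤-trans (≤-reflexive (sym (x∈p⇒𝟙≡1 j∈cr))) (m≤m+n _ _)
  ... | inj₂ (i , j∈Wᵢ) = ≤-trans (≤-reflexive (sym (x∈p⇒𝟙≡1 j∈Wᵢ)))
                            (≤-trans (≤-∑ (λ i → 𝟙 (lookup (W i) j)) i) (m≤n+m _ _))

∑-suc : (f : Fin k → ℕ) → ∑[ i < k ] suc (f i) ≡ k + sum f
∑-suc {k} f = trans (∑-distrib-+ (λ _ → 1) f) (cong (_+ sum f) (∑-const-1 k))

hypercircuit⇒k≤N : (H : Hypergraph n m) → IsHypercircuit H →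
                   (p : Fin n → Fin (suc (suc k))) → IsPartition p → suc (suc k) ≤ N H p
hypercircuit⇒k≤N {n} {k = k} H hyp@(refl , _) p surj = +-cancelʳ-≤ (sum ∣W∣) _ _ (begin
  suc (suc k) + sum ∣W∣             ≡⟨ ∑-suc ∣W∣ ⟨
  ∑[ i < suc (suc k) ] suc (∣W∣ i)  ≤⟨ ∑-mono-≤ part-has-fewer-inner-edges ⟩
  ∑[ i < suc (suc k) ] ∣ part p i ∣ ≡⟨ ∑∣part∣≡n p ⟩
  n                                 ≤⟨ m≤N+∑∣edgesWithin∣ H p ⟩
  N H p + sum ∣W∣                   ∎)
  where
  open ≤-Reasoning
  ∣W∣ : Fin (suc (suc k)) → ℕ
  ∣W∣ i = ∣ edgesWithin H (part p i) ∣
  part-has-fewer-inner-edges : ∀ i → ∣W∣ i < ∣ part p i ∣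
  part-has-fewer-inner-edges i =
    ∣edgesWithin∣<∣C∣ H hyp (part-nonempty surj i) (∁part-nonempty surj i)

theorem13 : ∀ (n m : ℕ) (H : Hypergraph n m) → IsHypercircuit H → PartitionConnected H
theorem13 n m H hyp zero          p surj = z≤n
theorem13 n m H hyp (suc zero)    p surj = z≤n
theorem13 n m H hyp (suc (suc k)) p surj =
  ≤-trans (n≤1+n (suc k)) (hypercircuit⇒k≤N H hyp p surj)
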